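{- If $R$ is the next row above or the next row below the row containing a 4-unit$_{s,3}$, in the same layer, then the unit of $R$ is not a special unit (i.e. not a 4-unit$_{s,1}$, 4-unit$_{s,2}$ or 4-unit$_{s,3}$).
   Context: Let $n\ge1$, $A_n=(a_1,\dots,a_n)$. For each $j\le n$ divisible by neither 2 nor 3 the layer $L_j$ is $\{a_{j2^k3^s}:k,s\ge0,\ j2^k3^s\le n\}$, with $a_{j2^k3^s}$ in row $s$, column $k$; each nonempty row $s$ is $a_{j3^s},a_{2j3^s},\dots$ in increasing order of $k$; row $0$ is the first row, row $1$ the second; the next row above/below row $s$ is row $s-1$/$s+1$. In each nonempty row, the unit of the row is the set of all its elements if the row has fewer than four elements, and its last four elements (largest $k$) otherwise; a unit with four elements is a 4-unit, written $\{a_i,a_{2i},a_{4i},a_{8i}\}$ with first element $a_i$. Special units: (1) 4-unit$_{s,1}$: the 4-unit in a layer $L_j$ with $|L_j|=9$ and $5\nmid j$; (2) 4-unit$_{s,2}$: the 4-unit in the first row of a layer $L_j$ with $5\nmid j$, where the first row has at least six elements and two more elements than the second row; (3) 4-unit$_{s,3}$: a 4-unit $\{a_i,a_{2i},a_{4i},a_{8i}\}$ in a layer $L_j$ with $5\nmid j$ such that $36\mid i$, and, with $R'$ the row containing it, the next row above $R'$ has two more elements than $R'$ and the next row below $R'$ has two fewer elements than $R'$. -}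

module Defs where

open import Data.Nat using (ℕ; zero; suc; _+_; _*_; _∸_; _^_; _≤_; _≤?_)
open import Data.Nat.Divisibility using (_∣_)
open import Data.List using (List; length; map; filter; drop; upTo)
open import Data.Nat.ListAction using (sum)
open import Data.Product using (Σ; _×_)
open import Data.Sum using (_⊎_)
open import Relation.Nullary using (¬_)
open import Relation.Binary.PropositionalEquality using (_≡_)

-- Positions (indices) of the sequence A_n = (a_1,…,a_n) are used to
-- represent elements a_i; all notions below are positional.

ValidLayer : ℕ → ℕ → Set
ValidLayer n j = 1 ≤ j × j ≤ n × ¬ (2 ∣ j) × ¬ (3 ∣ j)

-- Row s of layer L_j: indices j·3^s·2^k ≤ n in increasing order of k.
-- (For j ≥ 1 every such k satisfies k ≤ n, so k ranges over 0..n.)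
rowIdx : ℕ → ℕ → ℕ → List ℕ
rowIdx n j s = filter (λ i → i ≤? n) (map (λ k → j * 3 ^ s * 2 ^ k) (upTo (suc n)))

rowLen : ℕ → ℕ → ℕ → ℕ
rowLen n j s = length (rowIdx n j s)

unit : ℕ → ℕ → ℕ → List ℕ
unit n j s = drop (rowLen n j s ∸ 4) (rowIdx n j s)

Is4Unit : ℕ → ℕ → ℕ → Set
Is4Unit n j s = length (unit n j s) ≡ 4

unitFirst : ℕ → ℕ → ℕ → ℕ
unitFirst n j s = j * 3 ^ s * 2 ^ (rowLen n j s ∸ 4)

-- |L_j| (rows s > n are empty since 3^s > n)
layerSize : ℕ → ℕ → ℕ
layerSize n j = sum (map (rowLen n j) (upTo (suc n)))

Special1 : ℕ → ℕ → ℕ → Set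
Special1 n j s = Is4Unit n j s × layerSize n j ≡ 9 × ¬ (5 ∣ j)

Special2 : ℕ → ℕ → ℕ → Set
Special2 n j s = s ≡ 0 × Is4Unit n j s × ¬ (5 ∣ j)
               × 6 ≤ rowLen n j 0 × rowLen n j 0 ≡ rowLen n j 1 + 2

Special3 : ℕ → ℕ → ℕ → Set
Special3 n j s = Is4Unit n j s × ¬ (5 ∣ j) × 36 ∣ unitFirst n j s
               × Σ ℕ (λ t → s ≡ suc t × rowLen n j t ≡ rowLen n j s + 2)
               × rowLen n j (suc s) + 2 ≡ rowLen n j s

Special : ℕ → ℕ → ℕ → Set
Special n j s = Special1 n j s ⊎ Special2 n j s ⊎ Special3 n j s

{-# OPTIONS --safe #-}
-- Two adjacent rows of a layer differ by a factor 3 in their entries, so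
-- three rows down the row length can shrink by at most 5 (3³ < 2⁵).  A
-- 4-unit_{s,3} sits in a run of row lengths L + 2, L, L − 2; if the unit of
-- the row above or below were also a 4-unit_{s,3}, the run would extend to a
-- drop of 6 over three rows.  A 4-unit_{s,1} is impossible since the two rows
-- L + 2, L alone have at least 10 > 9 elements, and a 4-unit_{s,2} would force
-- the 4-unit_{s,3} into row 1, whose entries j·3·2ᵏ with 3 ∤ j are not
-- divisible by 9.
module Submission where

open import Defs
open import Data.Nat using (ℕ; zero; suc; _+_; _*_; _∸_; _^_; _≤_; _<_; _≤?_; z≤n; s≤s; >-nonZero)
open import Data.Nat.Properties
open import Data.Nat.Divisibility using (_∣_; divides; ∣-trans; *-cancelˡ-∣; ∣1⇒≡1; ∣⇒≤)
open import Data.Nat.Primality using (Prime; prime?; euclidsLemma)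
open import Data.Nat.ListAction using (sum)
open import Data.List using (length; filter; applyUpTo)
open import Data.List.Properties using (map-upTo; length-drop; filter-accept; filter-reject)
open import Data.Product using (_,_)
open import Data.Sum using (_⊎_; inj₁; inj₂; [_,_]′)
open import Function using (_∘_)
open import Relation.Binary.Definitions using (Monotonic₁)
open import Relation.Nullary using (¬_; yes; no; contradiction)
open import Relation.Nullary.Decidable using (from-yes)
open import Relation.Binary.PropositionalEquality using (_≡_; refl; sym; cong; subst)
open import Data.Nat.Solver using (module +-*-Solver)
open +-*-Solver

n<2^n : ∀ n → n < 2 ^ n
n<2^n zero    = s≤s z≤n
n<2^n (suc n) = +-mono-≤ (m^n>0 2 n) (≤-trans (n<2^n n) (m≤m+n (2 ^ n) 0))

countAtMost : ℕ → (ℕ → ℕ) → ℕ → ℕ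
countAtMost n g N = length (filter (_≤? n) (applyUpTo g N))

module _ {n : ℕ} where

  countAtMost-accept : ∀ {g} N → g 0 ≤ n →
                       countAtMost n g (suc N) ≡ suc (countAtMost n (g ∘ suc) N)
  countAtMost-accept {g} N g0≤n = cong length (filter-accept (_≤? n) g0≤n)

  countAtMost-reject : ∀ {g} N → ¬ g 0 ≤ n → countAtMost n g (suc N) ≡ countAtMost n (g ∘ suc) N
  countAtMost-reject {g} N g0≰n = cong length (filter-reject (_≤? n) g0≰n)

  countAtMost-sound : ∀ {g} N {k} → Monotonic₁ _≤_ _≤_ g →
                      k < countAtMost n g N → g k ≤ n
  countAtMost-sound zero    mono ()
  countAtMost-sound {g} (suc N) {k} mono k<c with g 0 ≤? n | k
  ... | yes g0≤n | zero  = g0≤n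
  ... | yes g0≤n | suc k =
    countAtMost-sound N (mono ∘ s≤s) (≤-pred (subst (suc k <_) (countAtMost-accept {g} N g0≤n) k<c))
  ... | no  g0≰n | k     = ≤-trans (mono (n≤1+n k))
    (countAtMost-sound N (mono ∘ s≤s) (subst (k <_) (countAtMost-reject {g} N g0≰n) k<c))

  countAtMost-maximal : ∀ {g} N → Monotonic₁ _≤_ _≤_ g →
                        n < g N → n < g (countAtMost n g N)
  countAtMost-maximal zero    mono n<gN = n<gN
  countAtMost-maximal {g} (suc N) mono n<gN with g 0 ≤? n
  ... | yes g0≤n = subst (λ c → n < g c) (sym (countAtMost-accept {g} N g0≤n))
                         (countAtMost-maximal N (mono ∘ s≤s) n<gN)
  ... | no  g0≰n = <-≤-trans (≰⇒> g0≰n) (mono z≤n)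

module _ {n j : ℕ} where

  rowLen≡countAtMost : ∀ s → rowLen n j s ≡ countAtMost n (λ k → j * 3 ^ s * 2 ^ k) (suc n)
  rowLen≡countAtMost s =
    cong (λ xs → length (filter (_≤? n) xs)) (map-upTo (λ k → j * 3 ^ s * 2 ^ k) (suc n))

  row-mono : ∀ s → Monotonic₁ _≤_ _≤_ (λ k → j * 3 ^ s * 2 ^ k)
  row-mono s k≤k′ = *-monoʳ-≤ (j * 3 ^ s) (^-monoʳ-≤ 2 k≤k′)

  rowLen-sound : ∀ s {k} → k < rowLen n j s → j * 3 ^ s * 2 ^ k ≤ n
  rowLen-sound s k<len =
    countAtMost-sound (suc n) (row-mono s) (subst (_ <_) (rowLen≡countAtMost s) k<len)

  rowLen-maximal : ∀ s → 1 ≤ j → n < j * 3 ^ s * 2 ^ rowLen n j s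
  rowLen-maximal s 1≤j = subst (λ c → n < j * 3 ^ s * 2 ^ c) (sym (rowLen≡countAtMost s))
    (countAtMost-maximal (suc n) (row-mono s) (begin-strict
      n                        <⟨ n<2^n n ⟩
      2 ^ n                    ≤⟨ ^-monoʳ-≤ 2 (n≤1+n n) ⟩
      2 ^ suc n                ≤⟨ m≤n*m (2 ^ suc n) (j * 3 ^ s) {{>-nonZero 1≤j*3^s}} ⟩
      j * 3 ^ s * 2 ^ suc n    ∎))
    where
      open ≤-Reasoning
      1≤j*3^s : 1 ≤ j * 3 ^ s
      1≤j*3^s = *-mono-≤ 1≤j (m^n>0 3 s)

  rowLen>0⇒s<n : ∀ s → 1 ≤ j → 0 < rowLen n j s → s < n
  rowLen>0⇒s<n s 1≤j 0<len = begin-strict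
    s                  <⟨ n<2^n s ⟩
    2 ^ s              ≤⟨ ^-monoˡ-≤ s (n≤1+n 2) ⟩
    3 ^ s              ≤⟨ m≤n*m (3 ^ s) j {{>-nonZero 1≤j}} ⟩
    j * 3 ^ s          ≡⟨ sym (*-identityʳ (j * 3 ^ s)) ⟩
    j * 3 ^ s * 2 ^ 0  ≤⟨ rowLen-sound s 0<len ⟩
    n                  ∎
    where open ≤-Reasoning

  rowLen≤5+rowLen[3+t] : ∀ t → 1 ≤ j → rowLen n j t ≤ 5 + rowLen n j (3 + t)
  rowLen≤5+rowLen[3+t] t 1≤j = ≮⇒≥ λ 5+b<len →
    <-irrefl refl (begin-strict
      32 * W                 ≡⟨ sym (32W≡ j (3 ^ t) (2 ^ b)) ⟩
      j * 3 ^ t * 2 ^ (5 + b) ≤⟨ rowLen-sound t 5+b<len ⟩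
      n                      <⟨ rowLen-maximal (3 + t) 1≤j ⟩
      j * 3 ^ (3 + t) * 2 ^ b ≡⟨ 27W≡ j (3 ^ t) (2 ^ b) ⟩
      27 * W                 ≤⟨ *-monoˡ-≤ W {27} {32} (m≤m+n 27 5) ⟩
      32 * W                 ∎)
    where
      open ≤-Reasoning
      b W : ℕ
      b = rowLen n j (3 + t)
      W = j * 3 ^ t * 2 ^ b
      32W≡ : ∀ x y z → x * y * (2 * (2 * (2 * (2 * (2 * z))))) ≡ 32 * (x * y * z)
      32W≡ = solve 3 (λ x y z → x :* y :* (con 2 :* (con 2 :* (con 2 :* (con 2 :* (con 2 :* z)))))
                                := con 32 :* (x :* y :* z)) refl
      27W≡ : ∀ x y z → x * (3 * (3 * (3 * y))) * z ≡ 27 * (x * y * z)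
      27W≡ = solve 3 (λ x y z → x :* (con 3 :* (con 3 :* (con 3 :* y))) :* z
                                := con 27 :* (x :* y :* z)) refl

Is4Unit⇒4≤rowLen : ∀ {n j s} → Is4Unit n j s → 4 ≤ rowLen n j s
Is4Unit⇒4≤rowLen {n} {j} {s} len≡4 =
  subst (_≤ rowLen n j s) (subst (_≡ 4) (length-drop (rowLen n j s ∸ 4) (rowIdx n j s)) len≡4)
        (m∸n≤m (rowLen n j s) (rowLen n j s ∸ 4))

adjacent≤sum-applyUpTo : ∀ (f : ℕ → ℕ) t {N} → suc t < N →
                         f t + f (suc t) ≤ sum (applyUpTo f N)
adjacent≤sum-applyUpTo f zero    {suc zero}    (s≤s ())
adjacent≤sum-applyUpTo f zero    {suc (suc N)} _ = +-monoʳ-≤ (f 0) (m≤m+n (f 1) _)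
adjacent≤sum-applyUpTo f (suc t) {suc N} 2+t<1+N =
  ≤-trans (adjacent≤sum-applyUpTo (f ∘ suc) t (≤-pred 2+t<1+N)) (m≤n+m _ (f 0))

Special3⇒10≤layerSize : ∀ {n j s} → 1 ≤ j → Special3 n j s → 10 ≤ layerSize n j
Special3⇒10≤layerSize {n} {j} 1≤j (4unit , _ , _ , (t , refl , above) , _) = begin
  10                                         ≤⟨ +-mono-≤ (+-monoˡ-≤ 2 4≤len) 4≤len ⟩
  rowLen n j (suc t) + 2 + rowLen n j (suc t) ≡⟨ cong (_+ rowLen n j (suc t)) (sym above) ⟩
  rowLen n j t + rowLen n j (suc t)          ≤⟨ adjacent≤sum-applyUpTo (rowLen n j) t (m<n⇒m<1+n suc-t<n) ⟩
  sum (applyUpTo (rowLen n j) (suc n))       ≡⟨ cong sum (sym (map-upTo (rowLen n j) (suc n))) ⟩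
  layerSize n j                              ∎
  where
    open ≤-Reasoning
    4≤len : 4 ≤ rowLen n j (suc t)
    4≤len = Is4Unit⇒4≤rowLen {n} {j} {suc t} 4unit
    suc-t<n : suc t < n
    suc-t<n = rowLen>0⇒s<n (suc t) 1≤j (≤-trans (s≤s z≤n) 4≤len)

Special3-not-consecutive : ∀ {n j s} → 1 ≤ j → Special3 n j s → ¬ Special3 n j (suc s)
Special3-not-consecutive 1≤j (_ , _ , _ , (u , refl , e₁) , _) (_ , _ , _ , (_ , refl , e₂) , e₃) =
  drop-by-six e₁ e₂ e₃ (rowLen≤5+rowLen[3+t] u 1≤j)
  where
    x+2+2+2≡6+x : ∀ x → x + 2 + 2 + 2 ≡ 6 + x
    x+2+2+2≡6+x = solve 1 (λ x → x :+ con 2 :+ con 2 :+ con 2 := con 6 :+ x) refl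
    drop-by-six : ∀ {a b c d} → a ≡ b + 2 → b ≡ c + 2 → d + 2 ≡ c → ¬ a ≤ 5 + d
    drop-by-six {d = d} refl refl refl =
      <-irrefl refl ∘ subst (_≤ 5 + d) (x+2+2+2≡6+x d)

prime-3 : Prime 3
prime-3 = from-yes (prime? 3)

3∤2^k : ∀ k → ¬ 3 ∣ 2 ^ k
3∤2^k zero    3∣1     = contradiction (∣1⇒≡1 3∣1) λ ()
3∤2^k (suc k) 3∣2^1+k = [ 3∤2 , 3∤2^k k ]′ (euclidsLemma 2 (2 ^ k) prime-3 3∣2^1+k)
  where
    3∤2 : ¬ 3 ∣ 2
    3∤2 = <⇒≱ ≤-refl ∘ ∣⇒≤

9∤m*3*2^k : ∀ {m} k → ¬ 3 ∣ m → ¬ 9 ∣ m * 3 * 2 ^ k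
9∤m*3*2^k {m} k 3∤m 9∣m*3*2^k = [ 3∤m , 3∤2^k k ]′ (euclidsLemma m (2 ^ k) prime-3 3∣m*2^k)
  where
    x*3*y≡3*[x*y] : ∀ x y → x * 3 * y ≡ 3 * (x * y)
    x*3*y≡3*[x*y] = solve 2 (λ x y → x :* con 3 :* y := con 3 :* (x :* y)) refl
    3∣m*2^k : 3 ∣ m * 2 ^ k
    3∣m*2^k = *-cancelˡ-∣ 3 (subst (9 ∣_) (x*3*y≡3*[x*y] m (2 ^ k)) 9∣m*3*2^k)

lemmaC2 : (n j s r : ℕ) → 1 ≤ n → ValidLayer n j → Special3 n j s
          → (suc r ≡ s ⊎ r ≡ suc s) → ¬ Special n j r
lemmaC2 _ _ _ _ _ (1≤j , _) sp₃ _ (inj₁ (_ , size≡9 , _)) =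
  <⇒≱ ≤-refl (subst (10 ≤_) size≡9 (Special3⇒10≤layerSize 1≤j sp₃))
lemmaC2 n j _ _ _ (_ , _ , _ , 3∤j) (_ , _ , 36∣first , _) (inj₁ refl) (inj₂ (inj₁ (refl , _))) =
  9∤m*3*2^k (rowLen n j 1 ∸ 4) 3∤j (∣-trans (divides 4 refl) 36∣first)
lemmaC2 _ _ _ _ _ _ _ (inj₂ refl) (inj₂ (inj₁ (() , _)))
lemmaC2 _ _ _ _ _ (1≤j , _) sp₃ (inj₁ refl) (inj₂ (inj₂ sp₃′)) = Special3-not-consecutive 1≤j sp₃′ sp₃
lemmaC2 _ _ _ _ _ (1≤j , _) sp₃ (inj₂ refl) (inj₂ (inj₂ sp₃′)) = Special3-not-consecutive 1≤j sp₃ sp₃′
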